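{- A Dyck path $\mathfrak p\in D_n^A$ is regular in $\mathcal{D}_n^A$ if and only if for every pair $(i,j)$ with $0\le i<j\le n$ the following holds: if $\mathfrak p$ has consecutive returns at $i$ and $j$, then the lattice point $(i,j)$ lies on $\mathfrak p$.
   Context: $D_n^A$: Dyck paths of type $A$ of semilength $n$, i.e. words of length $2n$ over $\{u,r\}$ with $n$ $u$'s and $n$ $r$'s in which every prefix has at least as many $u$'s as $r$'s, viewed as lattice paths from $(0,0)$ with $u=(0,1)$ and $r=(1,0)$. Height sequence $(h_1,\dots,h_n)$: $h_i$ is the number of $u$'s preceding the $i$-th $r$. $\mathcal{D}_n^A$ is $D_n^A$ ordered componentwise by height sequences, a finite distributive lattice and hence a Heyting algebra. The pseudocomplement $x^{\mathsf c}$ is the greatest $z$ with $x\wedge z=\hat0$; $x$ is regular if $(x^{\mathsf c})^{\mathsf c}=x$. The path has a return at $i$ if the point $(i,i)$ lies on it; returns at $i<j$ are consecutive if there is no return at any $k$ with $i<k<j$. -}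

module Defs where

open import Data.Nat using (ℕ; zero; suc; _+_; _≤_; _<_)
open import Data.List using (List; []; _∷_; take; length)
open import Data.List.Relation.Binary.Pointwise using (Pointwise)
open import Data.Product using (Σ; ∃; _×_; proj₁)
open import Relation.Binary.PropositionalEquality using (_≡_)
open import Relation.Nullary using (¬_)

-- Steps: u = (0,1) (up), r = (1,0) (right)
data Step : Set where
  u r : Step

#u : List Step → ℕ
#u []       = 0
#u (u ∷ w)  = suc (#u w)
#u (r ∷ w)  = #u w

#r : List Step → ℕ
#r []       = 0
#r (u ∷ w)  = #r w
#r (r ∷ w)  = suc (#r w)

IsDyck : ℕ → List Step → Set
IsDyck n w = #u w ≡ n × #r w ≡ n × (∀ k → #r (take k w) ≤ #u (take k w))

D : ℕ → Set
D n = Σ (List Step) (IsDyck n)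

-- height sequence: h_i = number of u's preceding the i-th r
heightsFrom : ℕ → List Step → List ℕ
heightsFrom h []       = []
heightsFrom h (u ∷ w)  = heightsFrom (suc h) w
heightsFrom h (r ∷ w)  = h ∷ heightsFrom h w

heights : List Step → List ℕ
heights = heightsFrom 0

_⊑_ : {n : ℕ} → D n → D n → Set
p ⊑ q = Pointwise _≤_ (heights (proj₁ p)) (heights (proj₁ q))

_≐_ : {n : ℕ} → D n → D n → Set
p ≐ q = proj₁ p ≡ proj₁ q

IsBottom : {n : ℕ} → D n → Set
IsBottom {n} b = ∀ (q : D n) → b ⊑ q

IsMeet : {n : ℕ} → D n → D n → D n → Set
IsMeet {n} x z m = m ⊑ x × m ⊑ z × (∀ (w : D n) → w ⊑ x → w ⊑ z → w ⊑ m)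

MeetIsBottom : {n : ℕ} → D n → D n → Set
MeetIsBottom {n} x z = ∀ (m : D n) → IsMeet x z m → IsBottom m

IsPseudocomplement : {n : ℕ} → D n → D n → Set
IsPseudocomplement {n} x c =
  MeetIsBottom x c × (∀ (z : D n) → MeetIsBottom x z → z ⊑ c)

Regular : {n : ℕ} → D n → Set
Regular {n} x = Σ (D n) λ c → Σ (D n) λ d →
  IsPseudocomplement x c × IsPseudocomplement c d × d ≐ x

OnPath : {n : ℕ} → D n → ℕ → ℕ → Set
OnPath p a b = ∃ λ k → #r (take k (proj₁ p)) ≡ a × #u (take k (proj₁ p)) ≡ b

Return : {n : ℕ} → D n → ℕ → Set
Return p i = OnPath p i i

ConsecutiveReturns : {n : ℕ} → D n → ℕ → ℕ → Set
ConsecutiveReturns p i j =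
  i < j × Return p i × Return p j × (∀ k → i < k → k < j → ¬ Return p k)

-- A path is determined by its height sequence h_1 ≤ … ≤ h_n with i ≤ h_i ≤ n, the
-- order is componentwise, meets are componentwise minima and 0̂ is h_i = i.  Hence
-- x ∧ z = 0̂ forces z_i = i wherever h_i > i, and x^c is given by c_i = i where h_i > i
-- and c_i = c_{i+1} where h_i = i (with c_{n+1} = n).  Applying this twice, x is
-- regular iff for each i either h_i = i or h_i = h_{i+1}.  Reading the path as the
-- monotone staircase G(a) = h_a (h_0 = 0, h_a = n beyond n), the point (a , b) lies
-- on it iff G(a) ≤ b ≤ G(a+1), so returns are the fixed points of G, and the local
-- condition says exactly that G(i+1) ≥ j for consecutive fixed points i < j.
module Submission where

open import Defs
open import Data.Nat using (ℕ; zero; suc; _+_; _∸_; _⊓_; _≤_; _<_; _≤?_; z≤n; s≤s; _≟_)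
open import Data.Nat.Properties
open import Data.List using (List; []; _∷_; take; zipWith)
open import Data.List.Relation.Binary.Pointwise using (Pointwise; []; _∷_; Pointwise-≡⇒≡)
import Data.List.Relation.Binary.Pointwise as Pointwise
open import Data.Product using (∃; _×_; _,_; proj₁; proj₂)
open import Data.Sum using (_⊎_; inj₁; inj₂)
open import Data.Unit using (⊤; tt)
open import Data.Empty using (⊥; ⊥-elim)
open import Relation.Binary.PropositionalEquality
open import Relation.Nullary using (¬_; yes; no)

-- Heights n k lo L: L can be the tail h_{k+1} … h_n of the height sequence
-- of a path in D n whose k-th height is lo (lo = 0 when k = 0).
data Heights (n : ℕ) : ℕ → ℕ → List ℕ → Set where
  end  : ∀ {k lo} → k ≡ n → Heights n k lo []
  next : ∀ {k lo h t} → lo ≤ h → k < h → h ≤ n → Heights n (suc k) h t →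
         Heights n k lo (h ∷ t)

Heights-[]-∷-absurd : ∀ {n k lo lo′ h t} {A : Set} →
  Heights n k lo [] → Heights n k lo′ (h ∷ t) → A
Heights-[]-∷-absurd (end refl) (next _ k<h h≤n _) = ⊥-elim (<-irrefl refl (<-≤-trans k<h h≤n))

Ballot : ℕ → ℕ → List Step → Set
Ballot k h w = ∀ m → k + #r (take m w) ≤ h + #u (take m w)

heightsFrom-Heights : ∀ {n} w k h lo → Ballot k h w → h + #u w ≡ n → k + #r w ≡ n → lo ≤ h →
  Heights n k lo (heightsFrom h w)
heightsFrom-Heights [] k h lo _ _ er _ = end (trans (sym (+-identityʳ k)) er)
heightsFrom-Heights (u ∷ w) k h lo ballot eu er lo≤h =
  heightsFrom-Heights w k (suc h) lo ballot′ (trans (sym (+-suc h (#u w))) eu) er (m≤n⇒m≤1+n lo≤h)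
  where
  ballot′ : Ballot k (suc h) w
  ballot′ m = subst (k + #r (take m w) ≤_) (+-suc h (#u (take m w))) (ballot (suc m))
heightsFrom-Heights (r ∷ w) k h lo ballot eu er lo≤h =
  next lo≤h k<h (subst (h ≤_) eu (m≤m+n h (#u w)))
    (heightsFrom-Heights w (suc k) h h ballot′ eu (trans (sym (+-suc k (#r w))) er) ≤-refl)
  where
  k<h : k < h
  k<h = subst₂ _≤_ (+-comm k 1) (+-identityʳ h) (ballot 1)
  ballot′ : Ballot (suc k) h w
  ballot′ m = subst (_≤ h + #u (take m w)) (+-suc k (#r (take m w))) (ballot (suc m))

heights-Heights : ∀ {n} (p : D n) → Heights n 0 0 (heights (proj₁ p))
heights-Heights (w , eu , er , ballot) = heightsFrom-Heights w 0 0 0 ballot eu er z≤n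

ups : ℕ → List Step → List Step
ups zero    w = w
ups (suc d) w = u ∷ ups d w

wordFrom : ℕ → List ℕ → List Step
wordFrom lo []      = []
wordFrom lo (h ∷ t) = ups (h ∸ lo) (r ∷ wordFrom h t)

heightsFrom-ups : ∀ d lo w → heightsFrom lo (ups d w) ≡ heightsFrom (lo + d) w
heightsFrom-ups zero    lo w = cong (λ x → heightsFrom x w) (sym (+-identityʳ lo))
heightsFrom-ups (suc d) lo w =
  trans (heightsFrom-ups d (suc lo) w) (cong (λ x → heightsFrom x w) (sym (+-suc lo d)))

#u-ups : ∀ d w → #u (ups d w) ≡ d + #u w
#u-ups zero    w = refl
#u-ups (suc d) w = cong suc (#u-ups d w)

#r-ups : ∀ d w → #r (ups d w) ≡ #r w
#r-ups zero    w = refl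
#r-ups (suc d) w = #r-ups d w

heightsFrom-wordFrom : ∀ {n k lo L} → Heights n k lo L → heightsFrom lo (wordFrom lo L) ≡ L
heightsFrom-wordFrom (end _) = refl
heightsFrom-wordFrom {lo = lo} (next {h = h} {t = t} lo≤h _ _ hs) = begin
  heightsFrom lo (ups (h ∸ lo) (r ∷ wordFrom h t)) ≡⟨ heightsFrom-ups (h ∸ lo) lo _ ⟩
  heightsFrom (lo + (h ∸ lo)) (r ∷ wordFrom h t)
    ≡⟨ cong (λ x → heightsFrom x (r ∷ wordFrom h t)) (m+[n∸m]≡n lo≤h) ⟩
  h ∷ heightsFrom h (wordFrom h t)                 ≡⟨ cong (h ∷_) (heightsFrom-wordFrom hs) ⟩
  h ∷ t                                            ∎
  where open ≡-Reasoning

#u-wordFrom : ∀ {n k lo L} → Heights n k lo L → k ≤ lo → lo ≤ n → lo + #u (wordFrom lo L) ≡ n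
#u-wordFrom (end refl) k≤lo lo≤n = trans (+-identityʳ _) (≤-antisym lo≤n k≤lo)
#u-wordFrom {lo = lo} (next {h = h} {t = t} lo≤h k<h h≤n hs) _ _ = begin
  lo + #u (ups (h ∸ lo) (r ∷ wordFrom h t)) ≡⟨ cong (lo +_) (#u-ups (h ∸ lo) _) ⟩
  lo + ((h ∸ lo) + #u (wordFrom h t))       ≡⟨ sym (+-assoc lo _ _) ⟩
  (lo + (h ∸ lo)) + #u (wordFrom h t)       ≡⟨ cong (_+ #u (wordFrom h t)) (m+[n∸m]≡n lo≤h) ⟩
  h + #u (wordFrom h t)                     ≡⟨ #u-wordFrom hs k<h h≤n ⟩
  _                                         ∎
  where open ≡-Reasoning

#r-wordFrom : ∀ {n k lo L} → Heights n k lo L → k + #r (wordFrom lo L) ≡ n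
#r-wordFrom {k = k} (end e) = trans (+-identityʳ k) e
#r-wordFrom {k = k} {lo} (next {h = h} {t = t} _ _ _ hs) =
  trans (cong (k +_) (#r-ups (h ∸ lo) (r ∷ wordFrom h t))) (trans (+-suc k _) (#r-wordFrom hs))

Ballot-here : ∀ {k h} w → k ≤ h → k + #r (take 0 w) ≤ h + #u (take 0 w)
Ballot-here {k} {h} _ k≤h = subst₂ _≤_ (sym (+-identityʳ k)) (sym (+-identityʳ h)) k≤h

Ballot-u : ∀ {k h w} → k ≤ h → Ballot k (suc h) w → Ballot k h (u ∷ w)
Ballot-u {w = w} k≤h _      zero    = Ballot-here (u ∷ w) k≤h
Ballot-u {k} {h} {w} _ ballot (suc m) = subst (k + #r (take m w) ≤_) (sym (+-suc h _)) (ballot m)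

Ballot-r : ∀ {k h w} → k ≤ h → Ballot (suc k) h w → Ballot k h (r ∷ w)
Ballot-r {w = w} k≤h _      zero    = Ballot-here (r ∷ w) k≤h
Ballot-r {k} {h} {w} _ ballot (suc m) = subst (_≤ h + #u (take m w)) (sym (+-suc k _)) (ballot m)

Ballot-ups : ∀ d {k h w} → k ≤ h → Ballot k (h + d) w → Ballot k h (ups d w)
Ballot-ups zero    {k} {h} {w} _   ballot = subst (λ x → Ballot k x w) (+-identityʳ h) ballot
Ballot-ups (suc d) {k} {h} {w} k≤h ballot =
  Ballot-u k≤h (Ballot-ups d (m≤n⇒m≤1+n k≤h) (subst (λ x → Ballot k x w) (+-suc h d) ballot))

Ballot-wordFrom : ∀ {n k lo L} → Heights n k lo L → k ≤ lo → Ballot k lo (wordFrom lo L)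
Ballot-wordFrom (end _) k≤lo zero    = Ballot-here [] k≤lo
Ballot-wordFrom (end _) k≤lo (suc _) = Ballot-here [] k≤lo
Ballot-wordFrom {k = k} {lo} (next {h = h} {t = t} lo≤h k<h _ hs) k≤lo =
  Ballot-ups (h ∸ lo) k≤lo (subst (λ x → Ballot k x (r ∷ wordFrom h t)) (sym (m+[n∸m]≡n lo≤h))
    (Ballot-r (<⇒≤ k<h) (Ballot-wordFrom hs k<h)))

pathOf : ∀ {n} (L : List ℕ) → Heights n 0 0 L → D n
pathOf L hs = wordFrom 0 L , #u-wordFrom hs z≤n z≤n , #r-wordFrom hs , Ballot-wordFrom hs z≤n

heights-pathOf : ∀ {n} (L : List ℕ) (hs : Heights n 0 0 L) → heights (proj₁ (pathOf L hs)) ≡ L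
heights-pathOf L hs = heightsFrom-wordFrom hs

_≤ₕ_ : List ℕ → List ℕ → Set
_≤ₕ_ = Pointwise _≤_

headOr : ℕ → List ℕ → ℕ
headOr x []      = x
headOr x (h ∷ _) = h

HeadGe : ℕ → List ℕ → Set
HeadGe x []      = ⊤
HeadGe x (h ∷ _) = x ≤ h

diagonal : ℕ → List ℕ → List ℕ
diagonal k []      = []
diagonal k (_ ∷ t) = suc k ∷ diagonal (suc k) t

minₕ : List ℕ → List ℕ → List ℕ
minₕ = zipWith _⊓_

-- On the tail h_{k+1} … h_n of a height sequence, pcFrom k and ccFrom k
-- compute the heights of x^c and of x^cc.
pcFrom : ℕ → List ℕ → List ℕ
pcFrom k [] = []
pcFrom k (h ∷ t) with h ≟ suc k
... | yes _ = headOr (suc k) (pcFrom (suc k) t) ∷ pcFrom (suc k) t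
... | no  _ = suc k ∷ pcFrom (suc k) t

ccFrom : ℕ → List ℕ → List ℕ
ccFrom k [] = []
ccFrom k (h ∷ t) with h ≟ suc k
... | yes _ = suc k ∷ ccFrom (suc k) t
... | no  _ = headOr (suc k) (ccFrom (suc k) t) ∷ ccFrom (suc k) t

headOr-≥ : ∀ {x y} L → HeadGe x L → y ≤ x → y ≤ headOr y L
headOr-≥ []      _   y≤x = ≤-refl
headOr-≥ (h ∷ L) x≤h y≤x = ≤-trans y≤x x≤h

headOr-≤ : ∀ {n k lo x L} → Heights n k lo L → x ≤ n → headOr x L ≤ n
headOr-≤ (end _)          x≤n = x≤n
headOr-≤ (next _ _ h≤n _) _   = h≤n

HeadGe-headOr : ∀ x L → HeadGe (headOr x L) L
HeadGe-headOr x []      = tt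
HeadGe-headOr x (h ∷ L) = ≤-refl

HeadGe-weaken : ∀ {x y} L → HeadGe x L → y ≤ x → HeadGe y L
HeadGe-weaken []      _   _   = tt
HeadGe-weaken (h ∷ L) x≤h y≤x = ≤-trans y≤x x≤h

Heights-lower : ∀ {n k lo lo′ L} → Heights n k lo L → HeadGe lo′ L → Heights n k lo′ L
Heights-lower (end e)            _     = end e
Heights-lower (next _ k<h h≤n hs) lo′≤h = next lo′≤h k<h h≤n hs

HeadGe-pcFrom : ∀ k t → HeadGe (suc k) (pcFrom k t)
HeadGe-pcFrom k [] = tt
HeadGe-pcFrom k (h ∷ t) with h ≟ suc k
... | yes _ = headOr-≥ (pcFrom (suc k) t) (HeadGe-pcFrom (suc k) t) (n≤1+n (suc k))
... | no  _ = ≤-refl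

pcFrom-Heights : ∀ {n k lo L} → Heights n k lo L → Heights n k k (pcFrom k L)
pcFrom-Heights (end e) = end e
pcFrom-Heights {k = k} (next {h = h} {t = t} _ k<h h≤n hs) with h ≟ suc k
... | yes _ = next (<⇒≤ k<c) k<c (headOr-≤ (pcFrom-Heights hs) (≤-trans k<h h≤n))
                (Heights-lower (pcFrom-Heights hs) (HeadGe-headOr (suc k) (pcFrom (suc k) t)))
  where
  k<c : k < headOr (suc k) (pcFrom (suc k) t)
  k<c = headOr-≥ (pcFrom (suc k) t) (HeadGe-pcFrom (suc k) t) (n≤1+n (suc k))
... | no  _ = next (n≤1+n k) ≤-refl (≤-trans k<h h≤n)
                (Heights-lower (pcFrom-Heights hs)
                  (HeadGe-weaken (pcFrom (suc k) t) (HeadGe-pcFrom (suc k) t) (n≤1+n _)))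

pcFrom-headOr : ∀ k P → HeadGe (suc (suc k)) P →
  pcFrom k (headOr (suc k) P ∷ P) ≡ suc k ∷ pcFrom (suc k) P
pcFrom-headOr k [] _ with suc k ≟ suc k
... | yes _ = refl
... | no ne = ⊥-elim (ne refl)
pcFrom-headOr k (c ∷ R) k+1<c with c ≟ suc k
... | yes c≡k+1 = ⊥-elim (<-irrefl (sym c≡k+1) k+1<c)
... | no  _     = refl

pcFrom-pcFrom : ∀ k L → pcFrom k (pcFrom k L) ≡ ccFrom k L
pcFrom-pcFrom k [] = refl
pcFrom-pcFrom k (h ∷ t) with h ≟ suc k
... | yes _ = trans (pcFrom-headOr k (pcFrom (suc k) t) (HeadGe-pcFrom (suc k) t))
                    (cong (suc k ∷_) (pcFrom-pcFrom (suc k) t))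
... | no _ with suc k ≟ suc k
...   | yes _ = cong₂ _∷_ (cong (headOr (suc k)) (pcFrom-pcFrom (suc k) t)) (pcFrom-pcFrom (suc k) t)
...   | no ne = ⊥-elim (ne refl)

diagonal-Heights : ∀ {n k lo lo′ L} → Heights n k lo L → lo′ ≤ suc k → Heights n k lo′ (diagonal k L)
diagonal-Heights (end e)            _      = end e
diagonal-Heights (next _ k<h h≤n hs) lo′≤k+1 =
  next lo′≤k+1 ≤-refl (≤-trans k<h h≤n) (diagonal-Heights hs (n≤1+n _))

minₕ-Heights : ∀ {n k lo lo′ a b} → Heights n k lo a → Heights n k lo′ b →
  Heights n k (lo ⊓ lo′) (minₕ a b)
minₕ-Heights (end e) (end _) = end e
minₕ-Heights as@(end _) bs@(next _ _ _ _) = Heights-[]-∷-absurd as bs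
minₕ-Heights as@(next _ _ _ _) bs@(end _) = Heights-[]-∷-absurd bs as
minₕ-Heights (next lo≤a k<a a≤n as) (next lo′≤b k<b _ bs) =
  next (⊓-mono-≤ lo≤a lo′≤b) (⊓-glb k<a k<b) (≤-trans (m⊓n≤m _ _) a≤n) (minₕ-Heights as bs)

minₕ-≤ˡ : ∀ {n k lo lo′ a b} → Heights n k lo a → Heights n k lo′ b → minₕ a b ≤ₕ a
minₕ-≤ˡ (end _) (end _) = []
minₕ-≤ˡ as@(end _) bs@(next _ _ _ _) = Heights-[]-∷-absurd as bs
minₕ-≤ˡ as@(next _ _ _ _) bs@(end _) = Heights-[]-∷-absurd bs as
minₕ-≤ˡ (next _ _ _ as) (next _ _ _ bs) = m⊓n≤m _ _ ∷ minₕ-≤ˡ as bs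

minₕ-≤ʳ : ∀ {n k lo lo′ a b} → Heights n k lo a → Heights n k lo′ b → minₕ a b ≤ₕ b
minₕ-≤ʳ (end _) (end _) = []
minₕ-≤ʳ as@(end _) bs@(next _ _ _ _) = Heights-[]-∷-absurd as bs
minₕ-≤ʳ as@(next _ _ _ _) bs@(end _) = Heights-[]-∷-absurd bs as
minₕ-≤ʳ (next _ _ _ as) (next _ _ _ bs) = m⊓n≤n _ _ ∷ minₕ-≤ʳ as bs

minₕ-glb : ∀ {c a b} → c ≤ₕ a → c ≤ₕ b → c ≤ₕ minₕ a b
minₕ-glb []           []           = []
minₕ-glb (c≤a ∷ c≤as) (c≤b ∷ c≤bs) = ⊓-glb c≤a c≤b ∷ minₕ-glb c≤as c≤bs

lowerBound-pcFrom-≤ₕ : ∀ {n k lo lo′ ms a qs} → Heights n k lo a →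
  ms ≤ₕ a → ms ≤ₕ pcFrom k a → Heights n k lo′ qs → ms ≤ₕ qs
lowerBound-pcFrom-≤ₕ (end _) [] [] (end _) = []
lowerBound-pcFrom-≤ₕ as@(end _) [] [] qs@(next _ _ _ _) = Heights-[]-∷-absurd as qs
lowerBound-pcFrom-≤ₕ as@(next _ _ _ _) (_ ∷ _) _ qs@(end _) = Heights-[]-∷-absurd qs as
lowerBound-pcFrom-≤ₕ {k = k} (next {h = h} _ _ _ as) (m≤h ∷ ms≤a) ms≤c (next _ k<q _ qs)
  with h ≟ suc k | ms≤c
... | yes h≡k+1 | _ ∷ ms≤c′ =
  ≤-trans (subst (_ ≤_) h≡k+1 m≤h) k<q ∷ lowerBound-pcFrom-≤ₕ as ms≤a ms≤c′ qs
... | no _      | m≤k+1 ∷ ms≤c′ =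
  ≤-trans m≤k+1 k<q ∷ lowerBound-pcFrom-≤ₕ as ms≤a ms≤c′ qs

headOr-pcFrom-≥ : ∀ {n k lo z t zs} → Heights n k lo t → Heights n k z zs → z ≤ n →
  zs ≤ₕ pcFrom k t → z ≤ headOr k (pcFrom k t)
headOr-pcFrom-≥ (end _) (end refl) z≤max [] = z≤max
headOr-pcFrom-≥ ts@(end _) zs@(next _ _ _ _) _ _ = Heights-[]-∷-absurd ts zs
headOr-pcFrom-≥ ts@(next _ _ _ _) zs@(end _) _ _ = Heights-[]-∷-absurd zs ts
headOr-pcFrom-≥ (next _ _ _ _) (next z≤z′ _ _ _) _ zs≤c = ≤-headOr zs≤c z≤z′
  where
  ≤-headOr : ∀ {z z′ y zt P} → (z′ ∷ zt) ≤ₕ P → z ≤ z′ → z ≤ headOr y P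
  ≤-headOr (z′≤c ∷ _) z≤z′ = ≤-trans z≤z′ z′≤c

minₕ-≤ₕ-diagonal⇒≤ₕ-pcFrom : ∀ {n k lo lo′ a zs} → Heights n k lo a → Heights n k lo′ zs →
  minₕ a zs ≤ₕ diagonal k a → zs ≤ₕ pcFrom k a
minₕ-≤ₕ-diagonal⇒≤ₕ-pcFrom (end _) (end _) [] = []
minₕ-≤ₕ-diagonal⇒≤ₕ-pcFrom as@(end _) zs@(next _ _ _ _) _ = Heights-[]-∷-absurd as zs
minₕ-≤ₕ-diagonal⇒≤ₕ-pcFrom as@(next _ _ _ _) zs@(end _) _ = Heights-[]-∷-absurd zs as
minₕ-≤ₕ-diagonal⇒≤ₕ-pcFrom {k = k}
  (next {h = h} {t = t} _ k<h _ as) (next {h = z} {t = zt} _ _ z≤max zs) (m≤k+1 ∷ rest)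
  with h ≟ suc k
... | yes _ = headOr-pcFrom-≥ as zs z≤max zs≤c ∷ zs≤c
  where
  zs≤c : zt ≤ₕ pcFrom (suc k) t
  zs≤c = minₕ-≤ₕ-diagonal⇒≤ₕ-pcFrom as zs rest
... | no h≢k+1 = z≤k+1 ∷ minₕ-≤ₕ-diagonal⇒≤ₕ-pcFrom as zs rest
  where
  -- h ⊓ z ≤ k + 1 < h, so the minimum is z
  z≤k+1 : z ≤ suc k
  z≤k+1 with ≤-total h z
  ... | inj₁ h≤z = ⊥-elim (h≢k+1 (≤-antisym (subst (_≤ suc k) (m≤n⇒m⊓n≡m h≤z) m≤k+1) k<h))
  ... | inj₂ z≤h = subst (_≤ suc k) (m≥n⇒m⊓n≡n z≤h) m≤k+1

pcFrom-isPseudocomplement : ∀ {n} (x c : D n) → heights (proj₁ c) ≡ pcFrom 0 (heights (proj₁ x)) →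
  IsPseudocomplement x c
pcFrom-isPseudocomplement {n} x c hc≡ = meetIsBottom , greatest
  where
  hx : List ℕ
  hx = heights (proj₁ x)
  xs : Heights n 0 0 hx
  xs = heights-Heights x

  meetIsBottom : MeetIsBottom x c
  meetIsBottom m (m⊑x , m⊑c , _) q =
    lowerBound-pcFrom-≤ₕ xs m⊑x (subst (_ ≤ₕ_) hc≡ m⊑c) (heights-Heights q)

  greatest : ∀ z → MeetIsBottom x z → z ⊑ c
  greatest z x∧z≡0 = subst (_ ≤ₕ_) (sym hc≡) (minₕ-≤ₕ-diagonal⇒≤ₕ-pcFrom xs zs min≤diag)
    where
    hz : List ℕ
    hz = heights (proj₁ z)
    zs : Heights n 0 0 hz
    zs = heights-Heights z
    mins : Heights n 0 0 (minₕ hx hz)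
    mins = minₕ-Heights xs zs
    meet : D n
    meet = pathOf (minₕ hx hz) mins
    diagonals : Heights n 0 0 (diagonal 0 hx)
    diagonals = diagonal-Heights xs z≤n
    bottom : D n
    bottom = pathOf (diagonal 0 hx) diagonals
    heights-meet : heights (proj₁ meet) ≡ minₕ hx hz
    heights-meet = heights-pathOf _ mins
    isMeet : IsMeet x z meet
    isMeet = subst (_≤ₕ hx) (sym heights-meet) (minₕ-≤ˡ xs zs)
           , subst (_≤ₕ hz) (sym heights-meet) (minₕ-≤ʳ xs zs)
           , λ w w⊑x w⊑z → subst (_ ≤ₕ_) (sym heights-meet) (minₕ-glb w⊑x w⊑z)
    min≤diag : minₕ hx hz ≤ₕ diagonal 0 hx
    min≤diag = subst₂ _≤ₕ_ heights-meet (heights-pathOf _ diagonals) (x∧z≡0 meet isMeet bottom)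

pseudocomplement-heights : ∀ {n} (x c : D n) → IsPseudocomplement x c →
  heights (proj₁ c) ≡ pcFrom 0 (heights (proj₁ x))
pseudocomplement-heights {n} x c (x∧c≡0 , c-greatest) =
  Pointwise-≡⇒≡ (Pointwise.antisymmetric ≤-antisym
    (subst (_ ≤ₕ_) heights-c₀ (proj₂ c₀-isPseudocomplement c x∧c≡0))
    (subst (_≤ₕ _) heights-c₀ (c-greatest c₀ (proj₁ c₀-isPseudocomplement))))
  where
  cs : Heights n 0 0 (pcFrom 0 (heights (proj₁ x)))
  cs = pcFrom-Heights (heights-Heights x)
  c₀ : D n
  c₀ = pathOf _ cs
  heights-c₀ : heights (proj₁ c₀) ≡ pcFrom 0 (heights (proj₁ x))
  heights-c₀ = heights-pathOf _ cs
  c₀-isPseudocomplement : IsPseudocomplement x c₀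
  c₀-isPseudocomplement = pcFrom-isPseudocomplement x c₀ heights-c₀

-- staircase n 0 (heights w) a = h_a, with the conventions h_0 = 0 and h_a = n for a > n.
staircase : ℕ → ℕ → List ℕ → ℕ → ℕ
staircase fin lo L       zero    = lo
staircase fin lo []      (suc a) = fin
staircase fin lo (h ∷ L) (suc a) = staircase fin h L a

staircase-suc-irrelevant : ∀ fin lo lo′ L a → staircase fin lo L (suc a) ≡ staircase fin lo′ L (suc a)
staircase-suc-irrelevant fin lo lo′ []      a = refl
staircase-suc-irrelevant fin lo lo′ (h ∷ L) a = refl

OnPathFrom : ℕ → List Step → ℕ → ℕ → Set
OnPathFrom h w a b = ∃ λ k → #r (take k w) ≡ a × h + #u (take k w) ≡ b

staircase-1-≥ : ∀ w h fin → fin ≡ h + #u w → h ≤ staircase fin h (heightsFrom h w) 1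
staircase-1-≥ []      h fin refl = ≤-reflexive (sym (+-identityʳ h))
staircase-1-≥ (u ∷ w) h fin ef   = ≤-trans (n≤1+n h)
  (subst (suc h ≤_) (staircase-suc-irrelevant fin (suc h) h (heightsFrom (suc h) w) 0)
    (staircase-1-≥ w (suc h) fin (trans ef (+-suc h (#u w)))))
staircase-1-≥ (r ∷ w) h fin ef   = ≤-refl

module _ (fin : ℕ) where

  onPathFrom⇒staircase : ∀ w h {a b} → fin ≡ h + #u w → OnPathFrom h w a b →
    a ≤ #r w × staircase fin h (heightsFrom h w) a ≤ b × b ≤ staircase fin h (heightsFrom h w) (suc a)
  onPathFrom⇒staircase w h ef (zero , refl , refl) =
    z≤n , m≤m+n h 0 ,
      subst (_≤ staircase fin h (heightsFrom h w) 1) (sym (+-identityʳ h)) (staircase-1-≥ w h fin ef)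
  onPathFrom⇒staircase [] h ef (suc k , refl , refl) =
    z≤n , m≤m+n h 0 , ≤-reflexive (sym ef)
  onPathFrom⇒staircase (u ∷ w) h {a} {b} ef (suc k , ra , ub)
    with onPathFrom⇒staircase w (suc h) (trans ef (+-suc h (#u w))) (k , ra , trans (sym (+-suc h _)) ub)
  ... | a≤#r , S′a≤b , b≤S′ =
    a≤#r , lower a S′a≤b , subst (b ≤_) (staircase-suc-irrelevant fin (suc h) h (heightsFrom (suc h) w) a) b≤S′
    where
    lower : ∀ a → staircase fin (suc h) (heightsFrom (suc h) w) a ≤ b → staircase fin h (heightsFrom (suc h) w) a ≤ b
    lower zero    h+1≤b = ≤-trans (n≤1+n h) h+1≤b
    lower (suc a) S′≤b  = subst (_≤ b) (staircase-suc-irrelevant fin (suc h) h (heightsFrom (suc h) w) a) S′≤b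
  onPathFrom⇒staircase (r ∷ w) h ef (suc k , refl , ub)
    with onPathFrom⇒staircase w h ef (k , refl , ub)
  ... | a≤#r , bounds = s≤s a≤#r , bounds

  staircase⇒onPathFrom : ∀ w h {a b} → fin ≡ h + #u w → a ≤ #r w →
    staircase fin h (heightsFrom h w) a ≤ b → b ≤ staircase fin h (heightsFrom h w) (suc a) →
    OnPathFrom h w a b
  staircase⇒onPathFrom [] h {zero} refl _ h≤b b≤fin =
    zero , refl , ≤-antisym (subst (_≤ _) (sym (+-identityʳ h)) h≤b) b≤fin
  staircase⇒onPathFrom (u ∷ w) h {zero} {b} ef _ h≤b b≤S with m≤n⇒m<n∨m≡n h≤b
  ... | inj₂ refl = zero , refl , +-identityʳ h
  ... | inj₁ h<b
    with staircase⇒onPathFrom w (suc h) (trans ef (+-suc h (#u w))) z≤n h<b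
           (subst (b ≤_) (staircase-suc-irrelevant fin h (suc h) (heightsFrom (suc h) w) 0) b≤S)
  ...   | k , ra , ub = suc k , ra , trans (+-suc h _) ub
  staircase⇒onPathFrom (u ∷ w) h {suc a} {b} ef a≤ Sa≤b b≤S
    with staircase⇒onPathFrom w (suc h) (trans ef (+-suc h (#u w))) a≤
           (subst (_≤ b) (staircase-suc-irrelevant fin h (suc h) (heightsFrom (suc h) w) a) Sa≤b)
           (subst (b ≤_) (staircase-suc-irrelevant fin h (suc h) (heightsFrom (suc h) w) (suc a)) b≤S)
  ... | k , ra , ub = suc k , ra , trans (+-suc h _) ub
  staircase⇒onPathFrom (r ∷ w) h {zero} _ _ h≤b b≤h = zero , refl , trans (+-identityʳ h) (≤-antisym h≤b b≤h)
  staircase⇒onPathFrom (r ∷ w) h {suc a} ef (s≤s a≤) Sa≤b b≤S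
    with staircase⇒onPathFrom w h ef a≤ Sa≤b b≤S
  ... | k , ra , ub = suc k , cong suc ra , ub

staircase-mono : ∀ {n k lo L} → Heights n k lo L → lo ≤ n →
  ∀ a → staircase n lo L a ≤ staircase n lo L (suc a)
staircase-mono (end _)            lo≤n zero    = lo≤n
staircase-mono (end _)            _    (suc a) = ≤-refl
staircase-mono (next lo≤h _ _ _)  _    zero    = lo≤h
staircase-mono (next _ _ h≤n hs)  _    (suc a) = staircase-mono hs h≤n a

staircase-≥ : ∀ {n k lo L} → Heights n k lo L → k ≤ lo →
  ∀ a → k + a ≤ n → k + a ≤ staircase n lo L a
staircase-≥ {k = k} _ k≤lo zero _ = subst (_≤ _) (sym (+-identityʳ k)) k≤lo
staircase-≥ (end _) _ (suc a) k+a≤n = k+a≤n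
staircase-≥ {n} {k} (next {h = h} {t = t} _ k<h _ hs) _ (suc a) k+a≤n =
  subst (_≤ staircase n h t a) (sym (+-suc k a)) (staircase-≥ hs k<h a (subst (_≤ n) (+-suc k a) k+a≤n))

staircase-top : ∀ {n k lo L} → Heights n k lo L → k ≤ lo → lo ≤ n →
  ∀ a → n ≤ k + a → staircase n lo L a ≡ n
staircase-top {k = k} _ k≤lo lo≤n zero n≤k =
  ≤-antisym lo≤n (≤-trans n≤k (subst (_≤ _) (sym (+-identityʳ k)) k≤lo))
staircase-top (end _) _ _ (suc a) _ = refl
staircase-top {n} {k} (next _ k<h h≤n hs) _ _ (suc a) n≤k+a =
  staircase-top hs k<h h≤n a (subst (n ≤_) (+-suc k a) n≤k+a)

headOr-staircase : ∀ {n k h t} → Heights n (suc k) h t → headOr (suc k) t ≡ staircase n h t 1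
headOr-staircase (end k+1≡n)     = k+1≡n
headOr-staircase (next _ _ _ _) = refl

FixedOrFlat : (ℕ → ℕ) → ℕ → ℕ → Set
FixedOrFlat G k a = G a ≡ k + a ⊎ G a ≡ G (suc a)

tail : List ℕ → List ℕ
tail []      = []
tail (_ ∷ t) = t

head : List ℕ → ℕ
head []      = 0
head (h ∷ _) = h

FixedOrFlat-shift : ∀ G k a → FixedOrFlat (λ x → G (suc x)) (suc k) a → FixedOrFlat G k (suc a)
FixedOrFlat-shift G k a (inj₁ e) = inj₁ (trans e (sym (+-suc k a)))
FixedOrFlat-shift G k a (inj₂ e) = inj₂ e

FixedOrFlat-unshift : ∀ G k a → FixedOrFlat G k (suc a) → FixedOrFlat (λ x → G (suc x)) (suc k) a
FixedOrFlat-unshift G k a (inj₁ e) = inj₁ (trans e (+-suc k a))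
FixedOrFlat-unshift G k a (inj₂ e) = inj₂ e

ccFrom-fixed-∷⁻ : ∀ k h t → h ∷ t ≡ ccFrom k (h ∷ t) →
  (h ≡ suc k ⊎ h ≡ headOr (suc k) t) × t ≡ ccFrom (suc k) t
ccFrom-fixed-∷⁻ k h t eq with h ≟ suc k
... | yes h≡k+1 = inj₁ h≡k+1 , cong tail eq
... | no _      = inj₂ (trans (cong head eq) (cong (headOr (suc k)) (sym (cong tail eq)))) , cong tail eq

ccFrom-fixed-∷⁺ : ∀ k h t → h ≡ suc k ⊎ h ≡ headOr (suc k) t → t ≡ ccFrom (suc k) t →
  h ∷ t ≡ ccFrom k (h ∷ t)
ccFrom-fixed-∷⁺ k h t cases t≡cc with h ≟ suc k | cases
... | yes h≡k+1 | _          = cong₂ _∷_ h≡k+1 t≡cc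
... | no h≢k+1  | inj₁ h≡k+1 = ⊥-elim (h≢k+1 h≡k+1)
... | no _      | inj₂ h≡    = cong₂ _∷_ (trans h≡ (cong (headOr (suc k)) t≡cc)) t≡cc

ccFrom-fixed⇒FixedOrFlat : ∀ {n k lo L} → Heights n k lo L → L ≡ ccFrom k L →
  ∀ a → FixedOrFlat (staircase n lo L) k (suc a)
ccFrom-fixed⇒FixedOrFlat (end _) _ a = inj₂ refl
ccFrom-fixed⇒FixedOrFlat {k = k} (next {h = h} {t = t} _ _ _ hs) L≡cc zero
  with proj₁ (ccFrom-fixed-∷⁻ k h t L≡cc)
... | inj₁ h≡k+1  = inj₁ (trans h≡k+1 (+-comm 1 k))
... | inj₂ h≡next = inj₂ (trans h≡next (headOr-staircase hs))
ccFrom-fixed⇒FixedOrFlat {n} {k} {lo} (next {h = h} {t = t} _ _ _ hs) L≡cc (suc a) =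
  FixedOrFlat-shift (staircase n lo (h ∷ t)) k (suc a)
    (ccFrom-fixed⇒FixedOrFlat hs (proj₂ (ccFrom-fixed-∷⁻ k h t L≡cc)) a)

FixedOrFlat⇒ccFrom-fixed : ∀ {n k lo L} → Heights n k lo L →
  (∀ a → FixedOrFlat (staircase n lo L) k (suc a)) → L ≡ ccFrom k L
FixedOrFlat⇒ccFrom-fixed (end _) _ = refl
FixedOrFlat⇒ccFrom-fixed {n} {k} {lo} (next {h = h} {t = t} _ _ _ hs) fixedOrFlat =
  ccFrom-fixed-∷⁺ k h t (headCase (fixedOrFlat 0)) t≡cc
  where
  t≡cc : t ≡ ccFrom (suc k) t
  t≡cc = FixedOrFlat⇒ccFrom-fixed hs λ a →
    FixedOrFlat-unshift (staircase n lo (h ∷ t)) k (suc a) (fixedOrFlat (suc a))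
  headCase : FixedOrFlat (staircase n lo (h ∷ t)) k 1 → h ≡ suc k ⊎ h ≡ headOr (suc k) t
  headCase (inj₁ h≡k+1)  = inj₁ (trans h≡k+1 (+-comm k 1))
  headCase (inj₂ h≡next) = inj₂ (trans h≡next (sym (headOr-staircase hs)))

module MonotoneFixedPoints (n : ℕ) (G : ℕ → ℕ) (G-zero : G 0 ≡ 0)
    (G-mono : ∀ a → G a ≤ G (suc a)) (G-top : ∀ a → n ≤ a → G a ≡ n) where

  Fixed : ℕ → Set
  Fixed a = G a ≡ a

  ConsecutiveFixed : ℕ → ℕ → Set
  ConsecutiveFixed i j = i < j × Fixed i × Fixed j × (∀ k → i < k → k < j → ¬ Fixed k)

  FixedOrFlatEverywhere : Set
  FixedOrFlatEverywhere = ∀ a → FixedOrFlat G 0 a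

  ConsecutiveFixedSpan : Set
  ConsecutiveFixedSpan = ∀ i j → j ≤ n → ConsecutiveFixed i j → j ≤ G (suc i)

  G-monotone : ∀ {a b} → a ≤ b → G a ≤ G b
  G-monotone {b = zero}  z≤n = ≤-refl
  G-monotone {b = suc b} a≤b+1 with m≤n⇒m<n∨m≡n a≤b+1
  ... | inj₂ refl      = ≤-refl
  ... | inj₁ (s≤s a≤b) = ≤-trans (G-monotone a≤b) (G-mono b)

  lastFixed≤ : ∀ a → ∃ λ i → i ≤ a × Fixed i × (∀ k → i < k → k ≤ a → ¬ Fixed k)
  lastFixed≤ zero = 0 , z≤n , G-zero , λ { k i<k z≤n _ → <-irrefl refl i<k }
  lastFixed≤ (suc a) with G (suc a) ≟ suc a
  ... | yes fixed = suc a , ≤-refl , fixed , λ k a+1<k k≤a+1 _ → <-irrefl refl (<-≤-trans a+1<k k≤a+1)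
  ... | no ¬fixed with lastFixed≤ a
  ...   | i , i≤a , fixed-i , none = i , m≤n⇒m≤1+n i≤a , fixed-i , none′
    where
    none′ : ∀ k → i < k → k ≤ suc a → ¬ Fixed k
    none′ k i<k k≤a+1 with m≤n⇒m<n∨m≡n k≤a+1
    ... | inj₂ refl      = ¬fixed
    ... | inj₁ (s≤s k≤a) = none k i<k k≤a

  firstFixed≥ : ∀ d a → a + d ≡ n →
    ∃ λ j → a ≤ j × j ≤ n × Fixed j × (∀ k → a ≤ k → k < j → ¬ Fixed k)
  firstFixed≥ zero a a+0≡n =
    a , ≤-refl , ≤-reflexive a≡n , trans (G-top a (≤-reflexive (sym a≡n))) (sym a≡n) ,
    λ k a≤k k<a _ → <-irrefl refl (<-≤-trans k<a a≤k)
    where a≡n = trans (sym (+-identityʳ a)) a+0≡n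
  firstFixed≥ (suc d) a a+d+1≡n with G a ≟ a
  ... | yes fixed = a , ≤-refl , subst (a ≤_) a+d+1≡n (m≤m+n a (suc d)) , fixed ,
                    λ k a≤k k<a _ → <-irrefl refl (<-≤-trans k<a a≤k)
  ... | no ¬fixed with firstFixed≥ d (suc a) (trans (sym (+-suc a d)) a+d+1≡n)
  ...   | j , a<j , j≤n , fixed-j , none = j , <⇒≤ a<j , j≤n , fixed-j , none′
    where
    none′ : ∀ k → a ≤ k → k < j → ¬ Fixed k
    none′ k a≤k k<j with m≤n⇒m<n∨m≡n a≤k
    ... | inj₂ refl = ¬fixed
    ... | inj₁ a<k  = none k a<k k<j

  fixedOrFlat⇒span : FixedOrFlatEverywhere → ConsecutiveFixedSpan
  fixedOrFlat⇒span fixedOrFlat i j _ (i<j , fixed-i , fixed-j , none) =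
    ≤-reflexive (sym (trans (flat j i<j ≤-refl) fixed-j))
    where
    flat : ∀ m → suc i ≤ m → m ≤ j → G (suc i) ≡ G m
    flat (suc m) i<m+1 m<j with m≤n⇒m<n∨m≡n i<m+1
    ... | inj₂ i+1≡m+1 = cong G i+1≡m+1
    ... | inj₁ (s≤s i<m) with fixedOrFlat m
    ...   | inj₁ fixed-m = ⊥-elim (none m i<m m<j fixed-m)
    ...   | inj₂ flat-m  = trans (flat m i<m (<⇒≤ m<j)) flat-m

  span⇒fixedOrFlat : ConsecutiveFixedSpan → FixedOrFlatEverywhere
  span⇒fixedOrFlat span a with n ≤? a
  ... | yes n≤a = inj₂ (trans (G-top a n≤a) (sym (G-top (suc a) (m≤n⇒m≤1+n n≤a))))
  ... | no n≰a with G a ≟ a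
  ...   | yes fixed = inj₁ fixed
  ...   | no ¬fixed with lastFixed≤ a | firstFixed≥ (n ∸ a) a (m+[n∸m]≡n (<⇒≤ (≰⇒> n≰a)))
  ...     | i , i≤a , fixed-i , none≤ | j , a≤j , j≤n , fixed-j , none≥ =
    inj₂ (≤-antisym (G-mono a) (begin
      G (suc a) ≤⟨ G-monotone a<j ⟩
      G j       ≡⟨ fixed-j ⟩
      j         ≤⟨ span i j j≤n (<-trans i<a a<j , fixed-i , fixed-j , none) ⟩
      G (suc i) ≤⟨ G-monotone i<a ⟩
      G a       ∎))
    where
    open ≤-Reasoning
    i<a : i < a
    i<a = ≤∧≢⇒< i≤a (λ i≡a → ¬fixed (subst Fixed i≡a fixed-i))
    a<j : a < j
    a<j = ≤∧≢⇒< a≤j (λ a≡j → ¬fixed (subst Fixed (sym a≡j) fixed-j))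
    none : ∀ k → i < k → k < j → ¬ Fixed k
    none k i<k k<j with ≤-total k a
    ... | inj₁ k≤a = none≤ k i<k k≤a
    ... | inj₂ a≤k = none≥ k a≤k k<j

Regular⇒ccFrom-fixed : ∀ {n} (p : D n) → Regular p →
  heights (proj₁ p) ≡ ccFrom 0 (heights (proj₁ p))
Regular⇒ccFrom-fixed p (c , d , p^c≡c , c^c≡d , d≐p) = begin
  heights (proj₁ p)                   ≡⟨ cong heights (sym d≐p) ⟩
  heights (proj₁ d)                   ≡⟨ pseudocomplement-heights c d c^c≡d ⟩
  pcFrom 0 (heights (proj₁ c))        ≡⟨ cong (pcFrom 0) (pseudocomplement-heights p c p^c≡c) ⟩
  pcFrom 0 (pcFrom 0 (heights (proj₁ p))) ≡⟨ pcFrom-pcFrom 0 (heights (proj₁ p)) ⟩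
  ccFrom 0 (heights (proj₁ p))        ∎
  where open ≡-Reasoning

ccFrom-fixed⇒Regular : ∀ {n} (p : D n) → heights (proj₁ p) ≡ ccFrom 0 (heights (proj₁ p)) → Regular p
ccFrom-fixed⇒Regular {n} p hp≡cc =
  c , p , pcFrom-isPseudocomplement p c heights-c , pcFrom-isPseudocomplement c p hp≡pcc , refl
  where
  cs : Heights n 0 0 (pcFrom 0 (heights (proj₁ p)))
  cs = pcFrom-Heights (heights-Heights p)
  c : D n
  c = pathOf _ cs
  heights-c : heights (proj₁ c) ≡ pcFrom 0 (heights (proj₁ p))
  heights-c = heights-pathOf _ cs
  hp≡pcc : heights (proj₁ p) ≡ pcFrom 0 (heights (proj₁ c))
  hp≡pcc = trans hp≡cc (trans (sym (pcFrom-pcFrom 0 (heights (proj₁ p)))) (cong (pcFrom 0) (sym heights-c)))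

ConsecutiveReturnsSpan : ∀ {n} → D n → Set
ConsecutiveReturnsSpan {n} p = ∀ i j → i < j → j ≤ n → ConsecutiveReturns p i j → OnPath p i j

module PathStaircase {n : ℕ} (p : D n) where

  w : List Step
  w = proj₁ p

  hs : Heights n 0 0 (heights w)
  hs = heights-Heights p

  G : ℕ → ℕ
  G = staircase n 0 (heights w)

  open MonotoneFixedPoints n G refl (staircase-mono hs z≤n) (staircase-top hs z≤n z≤n) public

  onPath⇒staircase : ∀ {a b} → OnPath p a b → a ≤ n × G a ≤ b × b ≤ G (suc a)
  onPath⇒staircase on with onPathFrom⇒staircase n w 0 (sym (proj₁ (proj₂ p))) on
  ... | a≤#r , Ga≤b , b≤G = subst (_ ≤_) (proj₁ (proj₂ (proj₂ p))) a≤#r , Ga≤b , b≤G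

  staircase⇒onPath : ∀ {a b} → a ≤ n → G a ≤ b → b ≤ G (suc a) → OnPath p a b
  staircase⇒onPath a≤n =
    staircase⇒onPathFrom n w 0 (sym (proj₁ (proj₂ p))) (subst (_ ≤_) (sym (proj₁ (proj₂ (proj₂ p)))) a≤n)

  return⇒fixed : ∀ {k} → Return p k → Fixed k
  return⇒fixed ret with onPath⇒staircase ret
  ... | k≤n , Gk≤k , _ = ≤-antisym Gk≤k (staircase-≥ hs z≤n _ k≤n)

  fixed⇒return : ∀ {k} → k ≤ n → Fixed k → Return p k
  fixed⇒return {k} k≤n fixed =
    staircase⇒onPath k≤n (≤-reflexive fixed) (subst (_≤ G (suc k)) fixed (staircase-mono hs z≤n k))

  ccFrom-fixed⇒FixedOrFlatEverywhere : heights w ≡ ccFrom 0 (heights w) → FixedOrFlatEverywhere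
  ccFrom-fixed⇒FixedOrFlatEverywhere _     zero    = inj₁ refl
  ccFrom-fixed⇒FixedOrFlatEverywhere fixed (suc a) = ccFrom-fixed⇒FixedOrFlat hs fixed a

  FixedOrFlatEverywhere⇒ccFrom-fixed : FixedOrFlatEverywhere → heights w ≡ ccFrom 0 (heights w)
  FixedOrFlatEverywhere⇒ccFrom-fixed fixedOrFlat = FixedOrFlat⇒ccFrom-fixed hs (λ a → fixedOrFlat (suc a))

  span⇒returnsSpan : ConsecutiveFixedSpan → ConsecutiveReturnsSpan p
  span⇒returnsSpan span i j i<j j≤n (_ , ret-i , ret-j , none) =
    staircase⇒onPath (<⇒≤ (<-≤-trans i<j j≤n)) (≤-trans (≤-reflexive (return⇒fixed ret-i)) (<⇒≤ i<j))
      (span i j j≤n (i<j , return⇒fixed ret-i , return⇒fixed ret-j ,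
        λ k i<k k<j fixed → none k i<k k<j (fixed⇒return (<⇒≤ (<-≤-trans k<j j≤n)) fixed)))

  returnsSpan⇒span : ConsecutiveReturnsSpan p → ConsecutiveFixedSpan
  returnsSpan⇒span returnsSpan i j j≤n (i<j , fixed-i , fixed-j , none) =
    proj₂ (proj₂ (onPath⇒staircase (returnsSpan i j i<j j≤n
      (i<j , fixed⇒return (<⇒≤ (<-≤-trans i<j j≤n)) fixed-i , fixed⇒return j≤n fixed-j ,
       λ k i<k k<j ret → none k i<k k<j (return⇒fixed ret)))))

corollary3p10 : (n : ℕ) (p : D n) →
    (Regular p →
    (∀ i j → i < j → j ≤ n → ConsecutiveReturns p i j → OnPath p i j))
    × ((∀ i j → i < j → j ≤ n → ConsecutiveReturns p i j → OnPath p i j) →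
    Regular p)
corollary3p10 n p =
  (λ regular → span⇒returnsSpan (fixedOrFlat⇒span
     (ccFrom-fixed⇒FixedOrFlatEverywhere (Regular⇒ccFrom-fixed p regular))))
  , λ returnsSpan → ccFrom-fixed⇒Regular p (FixedOrFlatEverywhere⇒ccFrom-fixed
     (span⇒fixedOrFlat (returnsSpan⇒span returnsSpan)))
  where open PathStaircase p
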